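{- Let $p<q$ be positive integers with $q-p$ and $p+q$ relatively prime, and let $B$, the inner graph $I$, the outer graph $O$, the key graph $H=I\cup O$ and the folding graph $F$ be as defined in the context. If the outer graph $O$ contains no cycles and the folding graph $F$ is connected, then the key graph $H$ is connected.
   Context: Let $N=2(p+q)$ and let $B$ be the board with cells $(x,y)$, $0\le x,y\le N-1$. For integers $x_1<x_2$, $y_1<y_2$, write $[x_1,x_2]\times[y_1,y_2]$ for the subboard of cells $(x,y)$ with $x_1\le x<x_2$, $y_1\le y<y_2$; the cell $(x_1+x,y_1+y)$ is said to be at position $(x,y)$ in it. For a subboard $S$ and a vector $d$, the pencil $S\to d$ is the set of edges joining $a$ and $a+d$ for all cells $a\in S$. The reflections of a set of cells or edges are its images under the identity and the maps $(x,y)\mapsto(N-1-x,y)$, $(x,y)\mapsto(x,N-1-y)$, $(x,y)\mapsto(N-1-x,N-1-y)$. Forward cores: $C'_1=[p,q]\times[p,q]$, $C'_2=[p+q,2q]\times[2p,p+q]$, $C'_3=[2p+q,p+2q]\times[2p+q,p+2q]$, $C'_4=[2p,p+q]\times[p+q,2q]$. Backward cores: $C''_1=[2p,p+q]\times[2p,p+q]$, $C''_2=[2p+q,p+2q]\times[p,q]$, $C''_3=[p+q,2q]\times[p+q,2q]$, $C''_4=[p,q]\times[2p+q,p+2q]$. Each core is a square of side $q-p$; a cell lies in 0, 1 or 2 cores. Forward rhombuses: for each $a\in C'_1$, the 4-cycle $a,\ a+(q,p),\ a+(p+q,p+q),\ a+(p,q),\ a$. Backward rhombuses: for each $a\in C''_1$,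 the 4-cycle $a,\ a+(q,-p),\ a+(q-p,q-p),\ a+(-p,q),\ a$. The inner graph $I$ is the union of all rhombuses. The outer graph $O$ (on vertex set all cells of $B$) is the union of the six pencils $[0,p]\times[0,q]\to(q,p)$, $[p,p+q]\times[0,p]\to(-p,q)$, $[0,p]\times[0,p]\to(p,q)$, $[q,p+q]\times[0,p]\to(-q,p)$, $[p,q]\times[0,p]\to(q,p)$, $[p,2p]\times[p,q]\to(-p,q)$ together with all their reflections (24 pencils). In $O$, each cell in no core has degree $2$, each cell in exactly one core has degree $1$, and each cell in two cores has degree $0$; so components of $O$ are paths and cycles, and the endpoints of each path component with at least one edge lie in exactly one core. Folding graph $F$: write $q-p=2s+1$; vertices are triples $(x,y,f)$ with $-s\le x,y\le s$, $f\in\{1,2\}$. For a cell $a$ at position $(x+s,y+s)$ in a forward core let $\pi_1(a)=(x,y,1)$; at position $(x+s,y+s)$ in a backward core let $\pi_2(a)=(x,y,2)$; if $a$ lies in a single core write $\pi(a)$ for its projection. Edges of $F$ (simple, no multiplicities): for each path component of $O$ with at least one edge and endpoints $a,b$, an edge $\pi(a)\pi(b)$; and for each cell $a$ lying in two cores, an edge $\pi_1(a)\pi_2(a)$. -}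

module Defs where

open import Data.Nat as ℕ using (ℕ; ⌊_/2⌋)
open import Data.Integer using (ℤ; +_; _+_; _-_; -_; _≤_; _<_)
open import Data.Fin using (Fin; zero; suc)
open import Data.Product using (_×_; _,_; Σ; ∃; ∃-syntax)
open import Data.Sum using (_⊎_)
open import Data.List using (List; []; _∷_; _∷ʳ_; length)
open import Data.List.Relation.Unary.Linked using (Linked)
open import Data.List.Relation.Unary.Unique.Propositional using (Unique)
open import Relation.Binary.PropositionalEquality using (_≡_; _≢_)
open import Relation.Binary.Construct.Closure.ReflexiveTransitive using (Star)

Cell : Set
Cell = ℤ × ℤ

_⊕_ : Cell → Cell → Cell
(a , b) ⊕ (c , d) = (a + c , b + d)

-- A subboard [x1,x2] × [y1,y2] is recorded as (x1 , x2 , y1 , y2).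
Subboard : Set
Subboard = ℤ × ℤ × ℤ × ℤ

_∈S_ : Cell → Subboard → Set
(x , y) ∈S (x1 , x2 , y1 , y2) = (x1 ≤ x × x < x2) × (y1 ≤ y × y < y2)

posIn : Subboard → Cell → Cell
posIn (x1 , x2 , y1 , y2) (x , y) = (x - x1 , y - y1)

-- Core directions: forward (label f = 1) and backward (label f = 2).
data Dir : Set where
  fwd bwd : Dir

data Refl : Set where
  r-id r-x r-y r-xy : Refl

Sym : {A : Set} → (A → A → Set) → A → A → Set
Sym E a b = E a b ⊎ E b a

HasCycle : {A : Set} → (A → A → Set) → Set
HasCycle {A} Adj = Σ (List A) λ vs → Σ A λ v →
  (3 ℕ.≤ length (v ∷ vs)) × Unique (v ∷ vs) × Linked Adj ((v ∷ vs) ∷ʳ v)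

module Board (p q : ℕ) where

  P Q N s : ℤ
  P = + p
  Q = + q
  N = + (2 ℕ.* (p ℕ.+ q))
  -- q - p = 2s + 1
  s = + ⌊ q ℕ.∸ p /2⌋

  InB : Cell → Set
  InB (x , y) = (+ 0 ≤ x × x < N) × (+ 0 ≤ y × y < N)

  refl-map : Refl → Cell → Cell
  refl-map r-id  (x , y) = (x , y)
  refl-map r-x   (x , y) = (N - + 1 - x , y)
  refl-map r-y   (x , y) = (x , N - + 1 - y)
  refl-map r-xy  (x , y) = (N - + 1 - x , N - + 1 - y)

  core : Dir → Fin 4 → Subboard
  -- forward cores C'_1 .. C'_4
  core fwd zero                   = (P , Q , P , Q)
  core fwd (suc zero)             = (P + Q , Q + Q , P + P , P + Q)
  core fwd (suc (suc zero))       = (P + P + Q , P + Q + Q , P + P + Q , P + Q + Q)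
  core fwd (suc (suc (suc zero))) = (P + P , P + Q , P + Q , Q + Q)
  -- backward cores C''_1 .. C''_4
  core bwd zero                   = (P + P , P + Q , P + P , P + Q)
  core bwd (suc zero)             = (P + P + Q , P + Q + Q , P , Q)
  core bwd (suc (suc zero))       = (P + Q , Q + Q , P + Q , Q + Q)
  core bwd (suc (suc (suc zero))) = (P , Q , P + P + Q , P + Q + Q)

  InOneCore : Cell → Set
  InOneCore a = ∃[ d ] ∃[ i ] (a ∈S core d i ×
                  (∀ d' i' → a ∈S core d' i' → (d' ≡ d × i' ≡ i)))

  rhombusEdge : Cell → Cell → Cell → Cell → Cell → Cell → Set
  rhombusEdge a1 a2 a3 a4 u v =
    ((u ≡ a1 × v ≡ a2) ⊎ (u ≡ a2 × v ≡ a3)) ⊎ ((u ≡ a3 × v ≡ a4) ⊎ (u ≡ a4 × v ≡ a1))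

  IEdge : Cell → Cell → Set
  IEdge u v =
    (∃[ a ] (a ∈S core fwd zero ×
       rhombusEdge a (a ⊕ (Q , P)) (a ⊕ (P + Q , P + Q)) (a ⊕ (P , Q)) u v))
    ⊎
    (∃[ a ] (a ∈S core bwd zero ×
       rhombusEdge a (a ⊕ (Q , - P)) (a ⊕ (Q - P , Q - P)) (a ⊕ (- P , Q)) u v))

  IAdj : Cell → Cell → Set
  IAdj = Sym IEdge

  pencil : Fin 6 → Subboard × Cell
  pencil zero = ((+ 0 , P , + 0 , Q) , (Q , P))
  pencil (suc zero) = ((P , P + Q , + 0 , P) , (- P , Q))
  pencil (suc (suc zero)) = ((+ 0 , P , + 0 , P) , (P , Q))
  pencil (suc (suc (suc zero))) = ((Q , P + Q , + 0 , P) , (- Q , P))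
  pencil (suc (suc (suc (suc zero)))) = ((P , Q , + 0 , P) , (Q , P))
  pencil (suc (suc (suc (suc (suc zero))))) = ((P , P + P , P , Q) , (- P , Q))

  PencilEdge : Subboard × Cell → Cell → Cell → Set
  PencilEdge (S , d) a b = a ∈S S × b ≡ a ⊕ d × InB a × InB b

  OEdge : Cell → Cell → Set
  OEdge u v = ∃[ k ] ∃[ r ] ∃[ a ] ∃[ b ]
    (PencilEdge (pencil k) a b × u ≡ refl-map r a × v ≡ refl-map r b)

  OAdj : Cell → Cell → Set
  OAdj = Sym OEdge

  HAdj : Cell → Cell → Set
  HAdj u v = IAdj u v ⊎ OAdj u v

  -- Folding graph F.  Vertices (x , y , f) with -s ≤ x,y ≤ s;
  -- f = 1 is encoded as fwd and f = 2 as bwd.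
  FVertex : Set
  FVertex = ℤ × ℤ × Dir

  InF : FVertex → Set
  InF (x , y , _) = (- s ≤ x × x ≤ s) × (- s ≤ y × y ≤ s)

  ProjIn : Dir → Fin 4 → Cell → FVertex → Set
  ProjIn d i a (x , y , f) =
    a ∈S core d i × f ≡ d × posIn (core d i) a ≡ (x + s , y + s)

  π-is : Cell → FVertex → Set
  π-is a u = InOneCore a × ∃[ d ] ∃[ i ] ProjIn d i a u

  -- a has degree exactly 1 in O (endpoint of a path component with ≥ 1 edge)
  Deg1 : Cell → Set
  Deg1 a = ∃[ b ] (OAdj a b × (∀ c → OAdj a c → c ≡ b))

  FEdgePath : FVertex → FVertex → Set
  FEdgePath u w = ∃[ a ] ∃[ b ]
    (a ≢ b × Deg1 a × Deg1 b × Star OAdj a b × π-is a u × π-is b w)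

  FEdgeDouble : FVertex → FVertex → Set
  FEdgeDouble u w = ∃[ a ] ∃[ i ] ∃[ j ]
    (ProjIn fwd i a u × ProjIn bwd j a w)

  FAdj : FVertex → FVertex → Set
  FAdj = Sym (λ u w → FEdgePath u w ⊎ FEdgeDouble u w)

  OAcyclic : Set
  OAcyclic = HasCycle OAdj → Data.Empty.⊥
    where import Data.Empty

  FConnected : Set
  FConnected = ∀ u w → InF u → InF w → Star FAdj u w

  HConnected : Set
  HConnected = ∀ a b → InB a → InB b → Star HAdj a b

module Submission where

-- Every cell of the board either lies in a core or has two distinct
-- O-neighbours (an explicit inspection of the six pencils, done on the
-- quadrant [0 , p + q)² and transported to the other quadrants by the four
-- reflections).  In a finite acyclic graph a walk that never turns back
-- cannot go on forever, so every cell is joined in O to a core cell.  Inside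
-- the cores the rhombuses of I join every core cell to the representative, in
-- C'₁ or C''₁, of its projection to F; consequently each edge of F lifts to
-- an H-path between representatives, and so does each F-path.  Joining two
-- cells through their cores and an F-path between the projections proves the
-- theorem.  The coprimality hypothesis is used only to know that the side
-- q - p of the cores is odd, so that projections land in F.

open import Defs
import Data.Nat as ℕ
import Data.Nat.Properties as ℕP
import Data.Nat.Tactic.RingSolver as ℕRing
import Data.Nat.Coprimality as Coprimality
open import Data.Nat.Divisibility using (divides)
open import Data.Product using (_×_; _,_; Σ; ∃; ∃₂; proj₁; proj₂)
open import Data.Product.Properties using (≡-dec)
import Data.Sum as Sum
open Sum using (_⊎_; inj₁; inj₂)
open import Data.Unit using (⊤; tt)
open import Data.Empty using (⊥; ⊥-elim)
open import Data.Fin using (Fin; zero; suc)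
open import Data.List using (List; []; _∷_; _∷ʳ_; length; map; upTo; cartesianProduct)
open import Data.List.Relation.Unary.Linked using (Linked; [-]; _∷_)
open import Data.List.Relation.Unary.Unique.Propositional using (Unique)
open import Data.List.Relation.Unary.AllPairs using ([]; _∷_)
open import Data.List.Relation.Unary.All as All using (All; []; _∷_)
open import Data.List.Relation.Unary.All.Properties using (¬Any⇒All¬)
open import Data.List.Relation.Unary.Any using (here; there)
open import Data.List.Membership.Propositional using (_∈_)
open import Data.List.Membership.Propositional.Properties using (∈-cartesianProduct⁺; ∈-map⁺; ∈-upTo⁺)
import Data.List.Membership.DecPropositional as DecMembership
open import Relation.Binary.Definitions using (DecidableEquality)
open import Relation.Binary.PropositionalEquality using (_≡_; _≢_; refl; sym; trans; cong; cong₂; subst; ≢-sym)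
open import Relation.Binary.Construct.Closure.ReflexiveTransitive using (Star; ε; _◅_; _◅◅_; gmap; kleisliStar; reverse)
open import Relation.Nullary using (¬_; yes; no)
open import Function using (id; _∘_)

delete : ∀ {A : Set} {x : A} (L : List A) → x ∈ L →
  Σ (List A) λ L' → length L ≡ ℕ.suc (length L') × (∀ {y} → y ∈ L → y ≢ x → y ∈ L')
delete (_ ∷ L) (here refl) = L , refl , λ { (here refl) y≢x → ⊥-elim (y≢x refl) ; (there y∈L) _ → y∈L }
delete (z ∷ L) (there x∈L) with delete L x∈L
... | L' , len , keep = z ∷ L' , cong ℕ.suc len , λ { (here refl) _ → here refl ; (there y∈L) y≢x → there (keep y∈L y≢x) }

unique-length-≤ : ∀ {A : Set} (xs L : List A) → Unique xs → (∀ {y} → y ∈ xs → y ∈ L) → length xs ℕ.≤ length L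
unique-length-≤ [] L _ _ = ℕ.z≤n
unique-length-≤ (x ∷ xs) L (x∉xs ∷ uxs) xs⊆L with delete L (xs⊆L (here refl))
... | L' , len , keep = subst (ℕ.suc (length xs) ℕ.≤_) (sym len)
  (ℕ.s≤s (unique-length-≤ xs L' uxs λ y∈xs → keep (xs⊆L (there y∈xs)) λ { refl → All.lookup x∉xs y∈xs refl }))

path-prefix : ∀ {A : Set} {R : A → A → Set} {w v : A} (x : A) (xs : List A) →
  Linked R (x ∷ xs) → Unique (x ∷ xs) → w ∈ xs → R w v →
  Σ (List A) λ ys → 1 ℕ.≤ length ys × Unique (x ∷ ys) × Linked R ((x ∷ ys) ∷ʳ v) × (∀ {z} → z ∈ ys → z ∈ xs)
path-prefix x (y ∷ xs) (x~y ∷ _) (x∉ ∷ _) (here refl) w~v =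
  y ∷ [] , ℕ.s≤s ℕ.z≤n , (All.head x∉ ∷ []) ∷ [] ∷ [] , x~y ∷ w~v ∷ [-] , λ { (here refl) → here refl }
path-prefix x (y ∷ xs) (x~y ∷ linked) (x∉ ∷ simple) (there w∈xs) w~v with path-prefix y xs linked simple w∈xs w~v
... | ys , len , uys , lys , ys⊆xs =
  y ∷ ys , ℕ.s≤s ℕ.z≤n ,
  All.tabulate (λ { (here refl) → All.head x∉ ; (there z∈ys) → All.lookup x∉ (there (ys⊆xs z∈ys)) }) ∷ uys ,
  x~y ∷ lys , λ { (here refl) → here refl ; (there z∈ys) → there (ys⊆xs z∈ys) }

TwoNeighbours : {A : Set} → (A → A → Set) → A → Set
TwoNeighbours _~_ a = ∃₂ λ b c → a ~ b × a ~ c × b ≢ c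

-- In a finite loopless acyclic graph in which every vertex outside a target
-- set has two distinct neighbours, every vertex is joined to the target set:
-- a walk that never turns back can neither close a cycle nor go on forever.
module AcyclicReach
  {A : Set} (_≟_ : DecidableEquality A) (_~_ : A → A → Set)
  (~-sym : ∀ {a b} → a ~ b → b ~ a) (~-irrefl : ∀ {a b} → a ~ b → a ≢ b)
  (acyclic : ¬ HasCycle _~_)
  (Dom : A → Set) (~-Dom : ∀ {a b} → a ~ b → Dom b)
  (universe : List A) (complete : ∀ {a} → Dom a → a ∈ universe)
  (Target : A → Set) (branch : ∀ {a} → Dom a → Target a ⊎ TwoNeighbours _~_ a)
  where

  open DecMembership _≟_ using (_∈?_)

  Reaches : A → Set
  Reaches a = ∃ λ t → Target t × Star _~_ a t

  -- w is not the vertex the path came from (paths are stored newest vertex first)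
  NotBack : List A → A → Set
  NotBack []      w = ⊤
  NotBack (u ∷ _) w = w ≢ u

  step : ∀ {v} prevs → TwoNeighbours _~_ v → ∃ λ w → v ~ w × NotBack prevs w
  step []      (b , c , v~b , v~c , b≢c) = b , v~b , tt
  step (u ∷ _) (b , c , v~b , v~c , b≢c) with b ≟ u
  ... | yes refl = c , v~c , λ { refl → b≢c refl }
  ... | no  b≢u  = b , v~b , b≢u

  -- Extending a simple path by a neighbour that is not the previous vertex
  -- cannot revisit the path: otherwise the graph would contain a cycle.
  no-return : ∀ {v w} prevs → Unique (v ∷ prevs) → Linked _~_ (v ∷ prevs) →
    v ~ w → NotBack prevs w → w ∈ (v ∷ prevs) → ⊥
  no-return prevs _ _ v~w _ (here refl) = ~-irrefl v~w refl
  no-return (u ∷ rest) _ _ _ w≢u (there (here refl)) = w≢u refl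
  no-return {v} (u ∷ rest) (v∉ ∷ simple) (v~u ∷ linked) v~w _ (there (there w∈rest))
    with path-prefix u rest linked simple w∈rest (~-sym v~w)
  ... | ys , len , uys , lys , ys⊆rest =
    acyclic (u ∷ ys , v , ℕ.s≤s (ℕ.s≤s len) , All.tabulate v∉cycle ∷ uys , v~u ∷ lys)
    where
      v∉cycle : ∀ {z} → z ∈ (u ∷ ys) → v ≢ z
      v∉cycle (here refl)  = All.head v∉
      v∉cycle (there z∈ys) = All.lookup v∉ (there (ys⊆rest z∈ys))

  -- Extend a simple path inside Dom until it reaches the target; the fuel
  -- bounds how much longer the path may grow before it outgrows the universe.
  walk : ∀ fuel v prevs → Unique (v ∷ prevs) → Linked _~_ (v ∷ prevs) → All Dom (v ∷ prevs) →
    length universe ℕ.< length (v ∷ prevs) ℕ.+ fuel → Reaches v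
  walk ℕ.zero v prevs simple _ inDom room =
    ⊥-elim (ℕP.<⇒≱ (subst (length universe ℕ.<_) (ℕP.+-identityʳ _) room)
                   (unique-length-≤ (v ∷ prevs) universe simple (λ z∈ → complete (All.lookup inDom z∈))))
  walk (ℕ.suc fuel) v prevs simple linked inDom room with branch (All.head inDom)
  ... | inj₁ target = v , target , ε
  ... | inj₂ two with step prevs two
  ... | w , v~w , notBack with w ∈? (v ∷ prevs)
  ... | yes w∈ = ⊥-elim (no-return prevs simple linked v~w notBack w∈)
  ... | no  w∉ with walk fuel w (v ∷ prevs) (¬Any⇒All¬ _ w∉ ∷ simple) (~-sym v~w ∷ linked) (~-Dom v~w ∷ inDom)
                      (subst (length universe ℕ.<_) (ℕP.+-suc _ fuel) room)
  ... | t , target , path = t , target , v~w ◅ path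

  reach : ∀ {a} → Dom a → Reaches a
  reach a∈ = walk (length universe) _ [] ([] ∷ []) [-] (a∈ ∷ []) (ℕP.n<1+n _)

half-split : ∀ n → n ≡ ℕ.⌊ n /2⌋ ℕ.+ ℕ.⌊ n /2⌋ ⊎ n ≡ ℕ.⌊ n /2⌋ ℕ.+ ℕ.⌊ n /2⌋ ℕ.+ 1
half-split 0 = inj₁ refl
half-split 1 = inj₂ refl
half-split (ℕ.suc (ℕ.suc n)) with half-split n
... | inj₁ e = inj₁ (cong ℕ.suc (trans (cong ℕ.suc e) (sym (ℕP.+-suc _ _))))
... | inj₂ e = inj₂ (cong ℕ.suc (trans (cong ℕ.suc e) (cong (ℕ._+ 1) (sym (ℕP.+-suc _ _)))))

-- If q - p and p + q are coprime then q - p is odd: otherwise 2 divides both.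
coprime-gap-odd : ∀ p q → p ℕ.≤ q → Coprimality.Coprime (q ℕ.∸ p) (p ℕ.+ q) →
  q ≡ p ℕ.+ (ℕ.⌊ q ℕ.∸ p /2⌋ ℕ.+ ℕ.⌊ q ℕ.∸ p /2⌋ ℕ.+ 1)
coprime-gap-odd p q p≤q coprime with half-split (q ℕ.∸ p)
... | inj₁ even = ⊥-elim (two≢one (coprime (divides k (trans even (k+k≡k*2 k)) ,
                                             divides (p ℕ.+ k) (trans (cong (p ℕ.+_) q≡) (p+[k+k] p k)))))
  where
    k = ℕ.⌊ q ℕ.∸ p /2⌋
    two≢one : 2 ≢ 1
    two≢one ()
    q≡ : q ≡ p ℕ.+ (k ℕ.+ k)
    q≡ = trans (sym (ℕP.m+[n∸m]≡n p≤q)) (cong (p ℕ.+_) even)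
    k+k≡k*2 : ∀ k → k ℕ.+ k ≡ k ℕ.* 2
    k+k≡k*2 = ℕRing.solve-∀
    p+[k+k] : ∀ p k → p ℕ.+ (p ℕ.+ (k ℕ.+ k)) ≡ (p ℕ.+ k) ℕ.* 2
    p+[k+k] = ℕRing.solve-∀
... | inj₂ odd = trans (sym (ℕP.m+[n∸m]≡n p≤q)) (cong (p ℕ.+_) odd)

module Intervals where
  open import Data.Integer using (ℤ; +_; -_; _+_; _-_; _≤_; _<_; _<?_)
  open import Data.Integer.Properties
  open import Data.Integer.Tactic.RingSolver using (solve-∀)
  open import Algebra.Properties.AbelianGroup +-0-abelianGroup using () renaming (∙-cancelˡ to +-cancelˡ)

  cancel-+- : ∀ x c → x + c - c ≡ x
  cancel-+- = solve-∀

  cancel--+ : ∀ x c → x - c + c ≡ x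
  cancel--+ = solve-∀

  plus-minus : ∀ a b → a + (b - a) ≡ b
  plus-minus = solve-∀

  mirror-mirror : ∀ m x → m - + 1 - (m - + 1 - x) ≡ x
  mirror-mirror = solve-∀

  private
    mirror-suc : ∀ m x → m - (+ 1 + x) ≡ m - + 1 - x
    mirror-suc = solve-∀

    mirror-pred : ∀ m x → - + 1 + (m - x) ≡ m - + 1 - x
    mirror-pred = solve-∀

  apart-x : ∀ x {u v a b : ℤ} → u ≢ v → (x + u , a) ≢ (x + v , b)
  apart-x x {u} {v} u≢v eq = u≢v (+-cancelˡ x u v (cong proj₁ eq))

  apart-y : ∀ y {u v a b : ℤ} → u ≢ v → (a , y + u) ≢ (b , y + v)
  apart-y y {u} {v} u≢v eq = u≢v (+-cancelˡ y u v (cong proj₂ eq))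

  compare : ∀ a b → a < b ⊎ b ≤ a
  compare a b with a <? b
  ... | yes a<b = inj₁ a<b
  ... | no  a≮b = inj₂ (≮⇒≥ a≮b)

  InRange : ℤ → ℤ → ℤ → Set
  InRange lo hi x = lo ≤ x × x < hi

  range-shift : ∀ c {lo hi x} → InRange lo hi x → InRange (lo + c) (hi + c) (x + c)
  range-shift c (lo≤x , x<hi) = +-monoˡ-≤ c lo≤x , +-monoˡ-< c x<hi

  range-shiftˡ : ∀ c {lo hi x} → InRange lo hi x → InRange (c + lo) (c + hi) (c + x)
  range-shiftˡ c (lo≤x , x<hi) = +-monoʳ-≤ c lo≤x , +-monoʳ-< c x<hi

  range-≡ : ∀ {lo lo' hi hi' x} → lo ≡ lo' → hi ≡ hi' → InRange lo hi x → InRange lo' hi' x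
  range-≡ refl refl r = r

  range-unshift : ∀ c {lo hi x} → InRange (lo + c) (hi + c) x → InRange lo hi (x - c)
  range-unshift c {lo} {hi} r = range-≡ (cancel-+- lo c) (cancel-+- hi c) (range-shift (- c) r)

  range-weaken : ∀ {lo lo' hi hi' x} → lo' ≤ lo → hi ≤ hi' → InRange lo hi x → InRange lo' hi' x
  range-weaken lo'≤lo hi≤hi' (lo≤x , x<hi) = ≤-trans lo'≤lo lo≤x , <-≤-trans x<hi hi≤hi'

  range-mirror : ∀ m {lo hi x} → InRange lo hi x → InRange (m - hi) (m - lo) (m - + 1 - x)
  range-mirror m {lo} {hi} {x} (lo≤x , x<hi) =
    subst (m - hi ≤_) (mirror-suc m x) (+-monoʳ-≤ m (neg-mono-≤ (i<j⇒suc[i]≤j x<hi))) ,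
    subst (_< m - lo) (mirror-pred m x) (<-≤-trans (i≤pred[j]⇒i<j ≤-refl) (+-monoʳ-≤ m (neg-mono-≤ lo≤x)))

module KeyGraph (p q : ℕ.ℕ) (0<p : 0 ℕ.< p) (p<q : p ℕ.< q)
                (coprime : Coprimality.Coprime (q ℕ.∸ p) (p ℕ.+ q)) where
  open import Data.Integer as ℤ using (ℤ; +_; -_; _+_; _-_; _≤_; _<_; +≤+; +<+)
  open import Data.Integer.Properties
  open import Data.Integer.Tactic.RingSolver using (solve-∀)
  open Intervals
  open Board p q

  0<P : + 0 < P
  0<P = +<+ 0<p

  P<Q : P < Q
  P<Q = +<+ p<q

  P≤Q : P ≤ Q
  P≤Q = <⇒≤ P<Q

  N≡ : N ≡ (P + P) + (Q + Q)
  N≡ = cong +_ (ring p q)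
    where
      ring : ∀ p q → 2 ℕ.* (p ℕ.+ q) ≡ (p ℕ.+ p) ℕ.+ (q ℕ.+ q)
      ring = ℕRing.solve-∀

  N-≡ : ∀ a {b} → (P + P) + (Q + Q) - a ≡ b → N - a ≡ b
  N-≡ a e = trans (cong (_- a) N≡) e

  side-odd : Q - P ≡ s + s + + 1
  side-odd = trans (cong (_- P) (cong +_ (coprime-gap-odd p q (ℕP.<⇒≤ p<q) coprime))) (ring (s + s + + 1) P)
    where
      ring : ∀ a b → b + a - b ≡ a
      ring = solve-∀

  flip : ℤ → ℤ
  flip x = N - + 1 - x

  flip-board : ∀ {x} → InRange (+ 0) N x → InRange (+ 0) N (flip x)
  flip-board b = range-≡ (+-inverseʳ N) (+-identityʳ N) (range-mirror N b)

  src : Fin 6 → Subboard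
  src k = proj₁ (pencil k)

  dir : Fin 6 → Cell
  dir k = proj₂ (pencil k)

  -- Every pencil joins two cells of [0 , 2q)², which lies inside the board.
  module _ where
    private
      Q≤2Q : Q ≤ Q + Q
      Q≤2Q = i≤i+j Q Q
      P≤2Q : P ≤ Q + Q
      P≤2Q = ≤-trans P≤Q Q≤2Q
      P+Q≤2Q : P + Q ≤ Q + Q
      P+Q≤2Q = +-monoˡ-≤ Q P≤Q
      Q+P≤2Q : Q + P ≤ Q + Q
      Q+P≤2Q = +-monoʳ-≤ Q P≤Q
      P+P≤2Q : P + P ≤ Q + Q
      P+P≤2Q = +-mono-≤ P≤Q P≤Q
      2Q≤N : Q + Q ≤ N
      2Q≤N = subst (Q + Q ≤_) (sym N≡) (i≤j+i (Q + Q) (P + P))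

      on-board : ∀ {n hi x} → hi ≤ Q + Q → InRange (+ n) hi x → InRange (+ 0) N x
      on-board hi≤2Q = range-weaken (+≤+ ℕ.z≤n) (≤-trans hi≤2Q 2Q≤N)

    pencil-edge : ∀ k {a} → a ∈S src k → PencilEdge (pencil k) a (a ⊕ dir k)
    pencil-edge zero {x , y} a∈@(hx , hy) = a∈ , refl ,
      (on-board P≤2Q hx , on-board Q≤2Q hy) , (on-board P+Q≤2Q (range-shift Q hx) , on-board Q+P≤2Q (range-shift P hy))
    pencil-edge (suc zero) {x , y} a∈@(hx , hy) = a∈ , refl ,
      (on-board P+Q≤2Q hx , on-board P≤2Q hy) ,
      (on-board Q≤2Q (range-unshift P (range-≡ refl (+-comm P Q) hx)) , on-board P+Q≤2Q (range-shift Q hy))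
    pencil-edge (suc (suc zero)) {x , y} a∈@(hx , hy) = a∈ , refl ,
      (on-board P≤2Q hx , on-board P≤2Q hy) , (on-board P+P≤2Q (range-shift P hx) , on-board P+Q≤2Q (range-shift Q hy))
    pencil-edge (suc (suc (suc zero))) {x , y} a∈@(hx , hy) = a∈ , refl ,
      (on-board P+Q≤2Q hx , on-board P≤2Q hy) , (on-board P≤2Q (range-unshift Q hx) , on-board P+P≤2Q (range-shift P hy))
    pencil-edge (suc (suc (suc (suc zero)))) {x , y} a∈@(hx , hy) = a∈ , refl ,
      (on-board Q≤2Q hx , on-board P≤2Q hy) , (on-board ≤-refl (range-shift Q hx) , on-board P+P≤2Q (range-shift P hy))
    pencil-edge (suc (suc (suc (suc (suc zero))))) {x , y} a∈@(hx , hy) = a∈ , refl ,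
      (on-board P+P≤2Q hx , on-board Q≤2Q hy) , (on-board P≤2Q (range-unshift P hx) , on-board ≤-refl (range-shift Q hy))

  pencil-adj : ∀ k r {a} → a ∈S src k → OAdj (refl-map r a) (refl-map r (a ⊕ dir k))
  pencil-adj k r {a} a∈ = inj₁ (k , r , a , a ⊕ dir k , pencil-edge k a∈ , refl , refl)

  pencil-edge⁻ : ∀ k {a b} → PencilEdge (pencil k) a b → b ≡ a ⊕ dir k × InB a × InB b
  pencil-edge⁻ zero                               (_ , e , ia , ib) = e , ia , ib
  pencil-edge⁻ (suc zero)                         (_ , e , ia , ib) = e , ia , ib
  pencil-edge⁻ (suc (suc zero))                   (_ , e , ia , ib) = e , ia , ib
  pencil-edge⁻ (suc (suc (suc zero)))             (_ , e , ia , ib) = e , ia , ib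
  pencil-edge⁻ (suc (suc (suc (suc zero))))       (_ , e , ia , ib) = e , ia , ib
  pencil-edge⁻ (suc (suc (suc (suc (suc zero))))) (_ , e , ia , ib) = e , ia , ib

  -- Every pencil moves the first coordinate, so O has no loops.
  module _ where
    private
      neg≢0 : ∀ {d} → d ≢ + 0 → - d ≢ + 0
      neg≢0 {d} d≢0 e = d≢0 (trans (sym (neg-involutive d)) (cong -_ e))
      P≢0 : P ≢ + 0
      P≢0 = ≢-sym (<⇒≢ 0<P)
      Q≢0 : Q ≢ + 0
      Q≢0 = ≢-sym (<⇒≢ (<-trans 0<P P<Q))

      dir-x≢0 : ∀ k → proj₁ (dir k) ≢ + 0
      dir-x≢0 zero                               = Q≢0
      dir-x≢0 (suc zero)                         = neg≢0 P≢0
      dir-x≢0 (suc (suc zero))                   = P≢0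
      dir-x≢0 (suc (suc (suc zero)))             = neg≢0 Q≢0
      dir-x≢0 (suc (suc (suc (suc zero))))       = Q≢0
      dir-x≢0 (suc (suc (suc (suc (suc zero))))) = neg≢0 P≢0

    dir-moves : ∀ k {x y} → (x , y) ≢ (x , y) ⊕ dir k
    dir-moves k {x} {y} e = apart-x x (≢-sym (dir-x≢0 k)) (trans (cong (λ t → t , y) (+-identityʳ x)) e)

  refl-invol : ∀ r c → refl-map r (refl-map r c) ≡ c
  refl-invol r-id (x , y) = refl
  refl-invol r-x  (x , y) = cong (λ t → t , y) (mirror-mirror N x)
  refl-invol r-y  (x , y) = cong (λ t → x , t) (mirror-mirror N y)
  refl-invol r-xy (x , y) = cong₂ _,_ (mirror-mirror N x) (mirror-mirror N y)

  refl-injective : ∀ r {c d} → refl-map r c ≡ refl-map r d → c ≡ d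
  refl-injective r {c} {d} e = trans (sym (refl-invol r c)) (trans (cong (refl-map r) e) (refl-invol r d))

  _∘r_ : Refl → Refl → Refl
  r-id ∘r r    = r
  r-x  ∘r r-id = r-x
  r-x  ∘r r-x  = r-id
  r-x  ∘r r-y  = r-xy
  r-x  ∘r r-xy = r-y
  r-y  ∘r r-id = r-y
  r-y  ∘r r-x  = r-xy
  r-y  ∘r r-y  = r-id
  r-y  ∘r r-xy = r-x
  r-xy ∘r r-id = r-xy
  r-xy ∘r r-x  = r-y
  r-xy ∘r r-y  = r-x
  r-xy ∘r r-xy = r-id

  refl-∘ : ∀ r r' c → refl-map r (refl-map r' c) ≡ refl-map (r ∘r r') c
  refl-∘ r-id r'   c       = refl
  refl-∘ r-x  r-id c       = refl
  refl-∘ r-x  r-x  c       = refl-invol r-x c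
  refl-∘ r-x  r-y  c       = refl
  refl-∘ r-x  r-xy (x , y) = cong (λ t → t , flip y) (mirror-mirror N x)
  refl-∘ r-y  r-id c       = refl
  refl-∘ r-y  r-x  c       = refl
  refl-∘ r-y  r-y  c       = refl-invol r-y c
  refl-∘ r-y  r-xy (x , y) = cong (λ t → flip x , t) (mirror-mirror N y)
  refl-∘ r-xy r-id c       = refl
  refl-∘ r-xy r-x  (x , y) = cong (λ t → t , flip y) (mirror-mirror N x)
  refl-∘ r-xy r-y  (x , y) = cong (λ t → flip x , t) (mirror-mirror N y)
  refl-∘ r-xy r-xy c       = refl-invol r-xy c

  refl-board : ∀ r {c} → InB c → InB (refl-map r c)
  refl-board r-id         b         = b
  refl-board r-x  {x , y} (bx , by) = flip-board bx , by
  refl-board r-y  {x , y} (bx , by) = bx , flip-board by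
  refl-board r-xy {x , y} (bx , by) = flip-board bx , flip-board by

  OAdj-sym : ∀ {a b} → OAdj a b → OAdj b a
  OAdj-sym = Sum.swap

  OAdj-≡ : ∀ {a a' b b'} → a ≡ a' → b ≡ b' → OAdj a b → OAdj a' b'
  OAdj-≡ refl refl e = e

  OAdj-reflect : ∀ r {a b} → OAdj a b → OAdj (refl-map r a) (refl-map r b)
  OAdj-reflect r = Sum.map reflect reflect
    where
      reflect : ∀ {a b} → OEdge a b → OEdge (refl-map r a) (refl-map r b)
      reflect (k , r' , a , b , pe , refl , refl) = k , r ∘r r' , a , b , pe , refl-∘ r r' a , refl-∘ r r' b

  OEdge-board : ∀ {a b} → OEdge a b → InB a × InB b
  OEdge-board (k , r , a , b , pe , refl , refl) =
    let (_ , ia , ib) = pencil-edge⁻ k pe in refl-board r ia , refl-board r ib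

  OAdj-board : ∀ {a b} → OAdj a b → InB b
  OAdj-board (inj₁ e) = proj₂ (OEdge-board e)
  OAdj-board (inj₂ e) = proj₁ (OEdge-board e)

  OEdge-irrefl : ∀ {a b} → OEdge a b → a ≢ b
  OEdge-irrefl (k , r , (x , y) , b , pe , refl , refl) e =
    dir-moves k (trans (refl-injective r e) (proj₁ (pencil-edge⁻ k pe)))

  OAdj-irrefl : ∀ {a b} → OAdj a b → a ≢ b
  OAdj-irrefl (inj₁ e) = OEdge-irrefl e
  OAdj-irrefl (inj₂ e) = OEdge-irrefl e ∘ sym

  -- The O-neighbours of a cell (x , y) of the quadrant [0 , p + q)².  A fwdₖ
  -- (bwdₖ) step follows pencil k forwards (backwards); mirror₄ and mirror₅
  -- follow the reflections of pencils 4 and 5 that reach into the quadrant.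

  module _ where
    private
      ring₁ : ∀ P Q → (P + P) + (Q + Q) - (P + Q + Q) ≡ P
      ring₁ = solve-∀
      ring₂ : ∀ P Q → (P + P) + (Q + Q) - (P + P + Q) ≡ Q
      ring₂ = solve-∀
      ring₃ : ∀ m z c → m - + 1 - (m - + 1 - (z + c) + c) ≡ z
      ring₃ = solve-∀

    strip : ∀ {z} → InRange (P + P) (P + Q) z → InRange P Q (flip (z + Q))
    strip h = range-≡ (N-≡ (P + Q + Q) (ring₁ P Q)) (N-≡ (P + P + Q) (ring₂ P Q)) (range-mirror N (range-shift Q h))

    flip-flip+ : ∀ z c → flip (flip (z + c) + c) ≡ z
    flip-flip+ = ring₃ N

  fwd₀ : ∀ {x y} → InRange (+ 0) P x → InRange (+ 0) Q y → OAdj (x , y) (x + Q , y + P)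
  fwd₀ hx hy = pencil-adj zero r-id (hx , hy)

  bwd₀ : ∀ {x y} → InRange Q (P + Q) x → InRange P (P + Q) y → OAdj (x , y) (x - Q , y - P)
  bwd₀ {x} {y} hx hy = OAdj-sym (OAdj-≡ refl (cong₂ _,_ (cancel--+ x Q) (cancel--+ y P))
    (pencil-adj zero r-id (range-unshift Q hx , range-unshift P (range-≡ refl (+-comm P Q) hy))))

  fwd₁ : ∀ {x y} → InRange P (P + Q) x → InRange (+ 0) P y → OAdj (x , y) (x - P , y + Q)
  fwd₁ hx hy = pencil-adj (suc zero) r-id (hx , hy)

  bwd₁ : ∀ {x y} → InRange (+ 0) Q x → InRange Q (P + Q) y → OAdj (x , y) (x + P , y - Q)
  bwd₁ {x} {y} hx hy = OAdj-sym (OAdj-≡ refl (cong₂ _,_ (cancel-+- x P) (cancel--+ y Q))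
    (pencil-adj (suc zero) r-id (range-≡ refl (+-comm Q P) (range-shift P hx) , range-unshift Q hy)))

  fwd₂ : ∀ {x y} → InRange (+ 0) P x → InRange (+ 0) P y → OAdj (x , y) (x + P , y + Q)
  fwd₂ hx hy = pencil-adj (suc (suc zero)) r-id (hx , hy)

  bwd₂ : ∀ {x y} → InRange P (P + P) x → InRange Q (P + Q) y → OAdj (x , y) (x - P , y - Q)
  bwd₂ {x} {y} hx hy = OAdj-sym (OAdj-≡ refl (cong₂ _,_ (cancel--+ x P) (cancel--+ y Q))
    (pencil-adj (suc (suc zero)) r-id (range-unshift P hx , range-unshift Q hy)))

  fwd₃ : ∀ {x y} → InRange Q (P + Q) x → InRange (+ 0) P y → OAdj (x , y) (x - Q , y + P)
  fwd₃ hx hy = pencil-adj (suc (suc (suc zero))) r-id (hx , hy)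

  bwd₃ : ∀ {x y} → InRange (+ 0) P x → InRange P (P + P) y → OAdj (x , y) (x + Q , y - P)
  bwd₃ {x} {y} hx hy = OAdj-sym (OAdj-≡ refl (cong₂ _,_ (cancel-+- x Q) (cancel--+ y P))
    (pencil-adj (suc (suc (suc zero))) r-id (range-shift Q hx , range-unshift P hy)))

  fwd₄ : ∀ {x y} → InRange P Q x → InRange (+ 0) P y → OAdj (x , y) (x + Q , y + P)
  fwd₄ hx hy = pencil-adj (suc (suc (suc (suc zero)))) r-id (hx , hy)

  mirror₄ : ∀ {x y} → InRange (P + P) (P + Q) x → InRange P (P + P) y → OAdj (x , y) (x + Q , y - P)
  mirror₄ {x} {y} hx hy = OAdj-sym (OAdj-≡ (cong (λ t → t , y - P) (mirror-mirror N (x + Q)))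
                                          (cong₂ _,_ (flip-flip+ x Q) (cancel--+ y P))
    (pencil-adj (suc (suc (suc (suc zero)))) r-x (strip hx , range-unshift P hy)))

  fwd₅ : ∀ {x y} → InRange P (P + P) x → InRange P Q y → OAdj (x , y) (x - P , y + Q)
  fwd₅ hx hy = pencil-adj (suc (suc (suc (suc (suc zero))))) r-id (hx , hy)

  mirror₅ : ∀ {x y} → InRange (+ 0) P x → InRange (P + P) (P + Q) y → OAdj (x , y) (x + P , y + Q)
  mirror₅ {x} {y} hx hy = OAdj-sym (OAdj-≡ (cong (λ t → x + P , t) (mirror-mirror N (y + Q)))
                                          (cong₂ _,_ (cancel-+- x P) (flip-flip+ y Q))
    (pencil-adj (suc (suc (suc (suc (suc zero))))) r-y (range-shift P hx , strip hy)))

  InHomeCore : Cell → Set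
  InHomeCore c = c ∈S core fwd zero ⊎ c ∈S core bwd zero

  private
    -Q<-P : - Q < - P
    -Q<-P = neg-mono-< P<Q
    -P<P : - P < P
    -P<P = <-trans (neg-mono-< 0<P) 0<P
    -Q<Q : - Q < Q
    -Q<Q = <-trans -Q<-P (<-trans -P<P P<Q)

    two : ∀ {c a b} → OAdj c a → OAdj c b → a ≢ b → InHomeCore c ⊎ TwoNeighbours OAdj c
    two c~a c~b a≢b = inj₂ (_ , _ , c~a , c~b , a≢b)

  -- Every cell of the quadrant lies in C'₁ or C''₁, or has two distinct
  -- O-neighbours: compare x and y with p, q and 2p; in each region outside the
  -- home cores two of the steps above apply, and they move the cell by
  -- different amounts.
  classify-quadrant : ∀ {x y} → InRange (+ 0) (P + Q) x → InRange (+ 0) (P + Q) y →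
                      InHomeCore (x , y) ⊎ TwoNeighbours OAdj (x , y)
  classify-quadrant {x} {y} (0≤x , x<P+Q) (0≤y , y<P+Q)
    with compare y P | compare y Q | compare y (P + P) | compare x P | compare x Q | compare x (P + P)
  ... | inj₁ y<P | _ | _ | inj₁ x<P | _ | _ =
    two (fwd₀ (0≤x , x<P) (0≤y , <-trans y<P P<Q)) (fwd₂ (0≤x , x<P) (0≤y , y<P)) (apart-x x (≢-sym (<⇒≢ P<Q)))
  ... | inj₁ y<P | _ | _ | inj₂ P≤x | inj₁ x<Q | _ =
    two (fwd₁ (P≤x , x<P+Q) (0≤y , y<P)) (fwd₄ (P≤x , x<Q) (0≤y , y<P)) (apart-x x (<⇒≢ (<-trans -P<P P<Q)))
  ... | inj₁ y<P | _ | _ | inj₂ P≤x | inj₂ Q≤x | _ =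
    two (fwd₁ (P≤x , x<P+Q) (0≤y , y<P)) (fwd₃ (Q≤x , x<P+Q) (0≤y , y<P)) (apart-x x (≢-sym (<⇒≢ -Q<-P)))
  ... | inj₂ P≤y | inj₁ y<Q | inj₁ y<2P | inj₁ x<P | _ | _ =
    two (fwd₀ (0≤x , x<P) (0≤y , y<Q)) (bwd₃ (0≤x , x<P) (P≤y , y<2P)) (apart-y y (≢-sym (<⇒≢ -P<P)))
  ... | inj₂ P≤y | inj₁ y<Q | inj₂ 2P≤y | inj₁ x<P | _ | _ =
    two (fwd₀ (0≤x , x<P) (0≤y , y<Q)) (mirror₅ (0≤x , x<P) (2P≤y , y<P+Q)) (apart-x x (≢-sym (<⇒≢ P<Q)))
  ... | inj₂ P≤y | inj₁ y<Q | _ | inj₂ P≤x | inj₁ x<Q | _ =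
    inj₁ (inj₁ ((P≤x , x<Q) , (P≤y , y<Q)))
  ... | inj₂ P≤y | inj₁ y<Q | _ | _ | inj₂ Q≤x | inj₁ x<2P =
    two (bwd₀ (Q≤x , x<P+Q) (P≤y , y<P+Q)) (fwd₅ (≤-trans P≤Q Q≤x , x<2P) (P≤y , y<Q)) (apart-x x (<⇒≢ -Q<-P))
  ... | inj₂ P≤y | inj₁ y<Q | inj₁ y<2P | _ | inj₂ Q≤x | inj₂ 2P≤x =
    two (bwd₀ (Q≤x , x<P+Q) (P≤y , y<P+Q)) (mirror₄ (2P≤x , x<P+Q) (P≤y , y<2P)) (apart-x x (<⇒≢ -Q<Q))
  ... | inj₂ P≤y | inj₁ y<Q | inj₂ 2P≤y | _ | inj₂ Q≤x | inj₂ 2P≤x =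
    inj₁ (inj₂ ((2P≤x , x<P+Q) , (2P≤y , y<P+Q)))
  ... | _ | inj₂ Q≤y | inj₁ y<2P | inj₁ x<P | _ | _ =
    two (bwd₁ (0≤x , <-trans x<P P<Q) (Q≤y , y<P+Q)) (bwd₃ (0≤x , x<P) (≤-trans P≤Q Q≤y , y<2P)) (apart-x x (<⇒≢ P<Q))
  ... | _ | inj₂ Q≤y | inj₂ 2P≤y | inj₁ x<P | _ | _ =
    two (bwd₁ (0≤x , <-trans x<P P<Q) (Q≤y , y<P+Q)) (mirror₅ (0≤x , x<P) (2P≤y , y<P+Q)) (apart-y y (<⇒≢ -Q<Q))
  ... | _ | inj₂ Q≤y | _ | inj₂ P≤x | inj₁ x<Q | inj₁ x<2P =
    two (bwd₁ (0≤x , x<Q) (Q≤y , y<P+Q)) (bwd₂ (P≤x , x<2P) (Q≤y , y<P+Q)) (apart-x x (≢-sym (<⇒≢ -P<P)))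
  ... | _ | inj₂ Q≤y | _ | _ | inj₁ x<Q | inj₂ 2P≤x =
    inj₁ (inj₂ ((2P≤x , x<P+Q) , (≤-trans 2P≤x (≤-trans (<⇒≤ x<Q) Q≤y) , y<P+Q)))
  ... | _ | inj₂ Q≤y | _ | _ | inj₂ Q≤x | inj₁ x<2P =
    two (bwd₀ (Q≤x , x<P+Q) (≤-trans P≤Q Q≤y , y<P+Q)) (bwd₂ (≤-trans P≤Q Q≤x , x<2P) (Q≤y , y<P+Q)) (apart-x x (<⇒≢ -Q<-P))
  ... | _ | inj₂ Q≤y | inj₁ y<2P | _ | inj₂ Q≤x | inj₂ 2P≤x =
    two (bwd₀ (Q≤x , x<P+Q) (≤-trans P≤Q Q≤y , y<P+Q)) (mirror₄ (2P≤x , x<P+Q) (≤-trans P≤Q Q≤y , y<2P)) (apart-x x (<⇒≢ -Q<Q))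
  ... | _ | inj₂ Q≤y | inj₂ 2P≤y | _ | inj₂ Q≤x | inj₂ 2P≤x =
    inj₁ (inj₂ ((2P≤x , x<P+Q) , (2P≤y , y<P+Q)))

  InCore : Cell → Set
  InCore c = ∃ λ d → ∃ λ i → c ∈S core d i

  module _ where
    private
      ring₄ : ∀ P Q → (P + P) + (Q + Q) - (P + Q) ≡ P + Q
      ring₄ = solve-∀
      ring₅ : ∀ P Q → (P + P) + (Q + Q) - Q ≡ P + P + Q
      ring₅ = solve-∀
      ring₆ : ∀ P Q → (P + P) + (Q + Q) - P ≡ P + Q + Q
      ring₆ = solve-∀
      ring₇ : ∀ P Q → (P + P) + (Q + Q) - (P + P) ≡ Q + Q
      ring₇ = solve-∀

    fold : ∀ {x} → InRange (P + Q) N x → InRange (+ 0) (P + Q) (flip x)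
    fold h = range-≡ (+-inverseʳ N) (N-≡ (P + Q) (ring₄ P Q)) (range-mirror N h)

    mirror-C' : ∀ {x} → InRange P Q x → InRange (P + P + Q) (P + Q + Q) (flip x)
    mirror-C' h = range-≡ (N-≡ Q (ring₅ P Q)) (N-≡ P (ring₆ P Q)) (range-mirror N h)

    mirror-C'' : ∀ {x} → InRange (P + P) (P + Q) x → InRange (P + Q) (Q + Q) (flip x)
    mirror-C'' h = range-≡ (N-≡ (P + Q) (ring₄ P Q)) (N-≡ (P + P) (ring₇ P Q)) (range-mirror N h)

  to-quadrant : ∀ {c} → InB c → ∃ λ r → refl-map r c ∈S (+ 0 , P + Q , + 0 , P + Q)
  to-quadrant {x , y} ((0≤x , x<N) , (0≤y , y<N)) with compare x (P + Q) | compare y (P + Q)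
  ... | inj₁ x< | inj₁ y< = r-id , (0≤x , x<) , (0≤y , y<)
  ... | inj₂ x≥ | inj₁ y< = r-x  , fold (x≥ , x<N) , (0≤y , y<)
  ... | inj₁ x< | inj₂ y≥ = r-y  , (0≤x , x<) , fold (y≥ , y<N)
  ... | inj₂ x≥ | inj₂ y≥ = r-xy , fold (x≥ , x<N) , fold (y≥ , y<N)

  reflect-home : ∀ r {c} → InHomeCore c → InCore (refl-map r c)
  reflect-home r-id         (inj₁ m)         = fwd , zero , m
  reflect-home r-id         (inj₂ m)         = bwd , zero , m
  reflect-home r-x  {x , y} (inj₁ (hx , hy)) = bwd , suc zero , mirror-C' hx , hy
  reflect-home r-x  {x , y} (inj₂ (hx , hy)) = fwd , suc zero , mirror-C'' hx , hy
  reflect-home r-y  {x , y} (inj₁ (hx , hy)) = bwd , suc (suc (suc zero)) , hx , mirror-C' hy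
  reflect-home r-y  {x , y} (inj₂ (hx , hy)) = fwd , suc (suc (suc zero)) , hx , mirror-C'' hy
  reflect-home r-xy {x , y} (inj₁ (hx , hy)) = fwd , suc (suc zero) , mirror-C' hx , mirror-C' hy
  reflect-home r-xy {x , y} (inj₂ (hx , hy)) = bwd , suc (suc zero) , mirror-C'' hx , mirror-C'' hy

  reflect-two : ∀ r {c} → TwoNeighbours OAdj (refl-map r c) → TwoNeighbours OAdj c
  reflect-two r {c} (a , b , c~a , c~b , a≢b) =
    refl-map r a , refl-map r b ,
    OAdj-≡ (refl-invol r c) refl (OAdj-reflect r c~a) ,
    OAdj-≡ (refl-invol r c) refl (OAdj-reflect r c~b) ,
    a≢b ∘ refl-injective r

  classify : ∀ {c} → InB c → InCore c ⊎ TwoNeighbours OAdj c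
  classify {c} b with to-quadrant b
  ... | r , hx , hy with classify-quadrant hx hy
  ... | inj₁ home = inj₁ (subst InCore (refl-invol r c) (reflect-home r home))
  ... | inj₂ two  = inj₂ (reflect-two r two)

  corner : Subboard → Cell
  corner (x1 , _ , y1 , _) = (x1 , y1)

  HasSide : ℤ → Subboard → Set
  HasSide L (x1 , x2 , y1 , y2) = x2 - x1 ≡ L × y2 - y1 ≡ L

  square-pos : ∀ {L} S {c X Y} → HasSide L S → c ∈S S → posIn S c ≡ (X , Y) →
    InRange (+ 0) L X × InRange (+ 0) L Y × c ≡ corner S ⊕ (X , Y)
  square-pos (x1 , x2 , y1 , y2) {cx , cy} (sx , sy) (hx , hy) refl =
    range-≡ (+-inverseʳ x1) sx (range-shift (- x1) hx) ,
    range-≡ (+-inverseʳ y1) sy (range-shift (- y1) hy) ,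
    cong₂ _,_ (sym (plus-minus x1 cx)) (sym (plus-minus y1 cy))

  module _ where
    private
      ring₁ : ∀ P Q → Q + Q - (P + Q) ≡ Q - P
      ring₁ = solve-∀
      ring₂ : ∀ P Q → P + Q - (P + P) ≡ Q - P
      ring₂ = solve-∀
      ring₃ : ∀ P Q → P + Q + Q - (P + P + Q) ≡ Q - P
      ring₃ = solve-∀
      ring₄ : ∀ P Q → P + P + (Q - P) ≡ P + Q
      ring₄ = solve-∀

    core-side : ∀ d i → HasSide (Q - P) (core d i)
    core-side fwd zero                   = refl , refl
    core-side fwd (suc zero)             = ring₁ P Q , ring₂ P Q
    core-side fwd (suc (suc zero))       = ring₃ P Q , ring₃ P Q
    core-side fwd (suc (suc (suc zero))) = ring₂ P Q , ring₁ P Q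
    core-side bwd zero                   = ring₂ P Q , ring₂ P Q
    core-side bwd (suc zero)             = ring₃ P Q , refl
    core-side bwd (suc (suc zero))       = ring₁ P Q , ring₁ P Q
    core-side bwd (suc (suc (suc zero))) = refl , ring₃ P Q

    base : Dir → Cell
    base fwd = (P , P)
    base bwd = (P + P , P + P)

    offset : Dir → Fin 4 → Cell
    offset _   zero                   = (+ 0 , + 0)
    offset fwd (suc zero)             = (Q , P)
    offset fwd (suc (suc zero))       = (P + Q , P + Q)
    offset fwd (suc (suc (suc zero))) = (P , Q)
    offset bwd (suc zero)             = (Q , - P)
    offset bwd (suc (suc zero))       = (Q - P , Q - P)
    offset bwd (suc (suc (suc zero))) = (- P , Q)

    core-corner : ∀ d i → corner (core d i) ≡ base d ⊕ offset d i
    core-corner fwd zero                   = sym (cong₂ _,_ (+-identityʳ P) (+-identityʳ P))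
    core-corner fwd (suc zero)             = refl
    core-corner fwd (suc (suc zero))       = cong₂ _,_ (+-assoc P P Q) (+-assoc P P Q)
    core-corner fwd (suc (suc (suc zero))) = refl
    core-corner bwd zero                   = sym (cong₂ _,_ (+-identityʳ (P + P)) (+-identityʳ (P + P)))
    core-corner bwd (suc zero)             = cong (λ t → P + P + Q , t) (sym (cancel-+- P P))
    core-corner bwd (suc (suc zero))       = sym (cong₂ _,_ (ring₄ P Q) (ring₄ P Q))
    core-corner bwd (suc (suc (suc zero))) = cong (λ t → t , P + P + Q) (sym (cancel-+- P P))

    home-square : ∀ d {X Y} → InRange (+ 0) (Q - P) X → InRange (+ 0) (Q - P) Y → (base d ⊕ (X , Y)) ∈S core d zero
    home-square fwd hX hY = range-≡ (+-identityʳ P) (plus-minus P Q) (range-shiftˡ P hX) ,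
                            range-≡ (+-identityʳ P) (plus-minus P Q) (range-shiftˡ P hY)
    home-square bwd hX hY = range-≡ (+-identityʳ (P + P)) (ring₄ P Q) (range-shiftˡ (P + P) hX) ,
                            range-≡ (+-identityʳ (P + P)) (ring₄ P Q) (range-shiftˡ (P + P) hY)

  -- Projection of core cells to F: positions in a core of side 2s + 1 are
  -- centred by subtracting s.

  centred : ∀ {X} → InRange (+ 0) (Q - P) X → - s ≤ X - s × X - s ≤ s
  centred {X} h with range-shift (- s) h
  ... | lo , hi = subst (_≤ X - s) (+-identityˡ (- s)) lo ,
                  subst (X - s ≤_) (pred-suc s) (i<j⇒i≤pred[j] (subst (X - s <_) upper hi))
    where
      ring : ∀ s → s + s + + 1 - s ≡ + 1 + s
      ring = solve-∀
      upper : Q - P - s ≡ + 1 + s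
      upper = trans (cong (_- s) side-odd) (ring s)

  core-proj : ∀ d i {c} → c ∈S core d i → ∃ λ u → ProjIn d i c u × InF u
  core-proj d i {c} m with square-pos (core d i) (core-side d i) m refl
  ... | hX , hY , _ =
    (X - s , Y - s , d) , (m , refl , cong₂ _,_ (sym (cancel--+ X s)) (sym (cancel--+ Y s))) , centred hX , centred hY
    where
      X = proj₁ (posIn (core d i) c)
      Y = proj₂ (posIn (core d i) c)

  H-sym : ∀ {a b} → HAdj a b → HAdj b a
  H-sym = Sum.map Sum.swap Sum.swap

  H-reverse : ∀ {a b} → Star HAdj a b → Star HAdj b a
  H-reverse = reverse H-sym

  O⊆H : ∀ {a b} → Star OAdj a b → Star HAdj a b
  O⊆H = gmap id inj₂

  rhombus-edge : ∀ d {a} → a ∈S core d zero → ∀ {u v} →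
    rhombusEdge a (a ⊕ offset d (suc zero)) (a ⊕ offset d (suc (suc zero))) (a ⊕ offset d (suc (suc (suc zero)))) u v →
    IEdge u v
  rhombus-edge fwd m e = inj₁ (_ , m , e)
  rhombus-edge bwd m e = inj₂ (_ , m , e)

  rhombus : ∀ d i {a} → a ∈S core d zero → Star HAdj (a ⊕ offset d i) a
  rhombus d zero {x , y} _ = subst (λ c → Star HAdj c (x , y)) (sym (cong₂ _,_ (+-identityʳ x) (+-identityʳ y))) ε
  rhombus d (suc zero) m = inj₁ (inj₂ (rhombus-edge d m (inj₁ (inj₁ (refl , refl))))) ◅ ε
  rhombus d (suc (suc zero)) m = inj₁ (inj₂ (rhombus-edge d m (inj₁ (inj₂ (refl , refl))))) ◅ rhombus d (suc zero) m
  rhombus d (suc (suc (suc zero))) m = inj₁ (inj₁ (rhombus-edge d m (inj₂ (inj₂ (refl , refl))))) ◅ ε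

  rep : FVertex → Cell
  rep (x , y , d) = base d ⊕ (x + s , y + s)

  ⊕-swap : ∀ b o v → (b ⊕ o) ⊕ v ≡ (b ⊕ v) ⊕ o
  ⊕-swap (b₁ , b₂) (o₁ , o₂) (v₁ , v₂) = cong₂ _,_ (ring b₁ o₁ v₁) (ring b₂ o₂ v₂)
    where
      ring : ∀ b o v → b + o + v ≡ b + v + o
      ring = solve-∀

  to-rep : ∀ d i {c} u → ProjIn d i c u → Star HAdj c (rep u)
  to-rep d i {c} (x , y , _) (m , refl , pos) with square-pos (core d i) (core-side d i) m pos
  ... | hX , hY , c≡ = subst (λ z → Star HAdj z (rep (x , y , d))) (sym c-at-rhombus) (rhombus d i (home-square d hX hY))
    where
      c-at-rhombus : c ≡ rep (x , y , d) ⊕ offset d i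
      c-at-rhombus = trans c≡ (trans (cong (_⊕ (x + s , y + s)) (core-corner d i)) (⊕-swap (base d) (offset d i) _))

  lift-edge : ∀ {u w} → FEdgePath u w ⊎ FEdgeDouble u w → Star HAdj (rep u) (rep w)
  lift-edge {u} {w} (inj₁ (a , b , _ , _ , _ , a⇝b , (_ , d , i , πa) , (_ , d' , i' , πb))) =
    H-reverse (to-rep d i u πa) ◅◅ O⊆H a⇝b ◅◅ to-rep d' i' w πb
  lift-edge {u} {w} (inj₂ (a , i , j , π₁a , π₂a)) = H-reverse (to-rep fwd i u π₁a) ◅◅ to-rep bwd j w π₂a

  lift-adj : ∀ {u w} → FAdj u w → Star HAdj (rep u) (rep w)
  lift-adj {u} {w} (inj₁ e) = lift-edge {u} {w} e
  lift-adj {u} {w} (inj₂ e) = H-reverse (lift-edge {w} {u} e)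

  lift-path : ∀ {u w} → Star FAdj u w → Star HAdj (rep u) (rep w)
  lift-path = kleisliStar rep (λ {u} {w} → lift-adj {u} {w})

  board-cells : List Cell
  board-cells = cartesianProduct coordinates coordinates
    where coordinates = map +_ (upTo (2 ℕ.* (p ℕ.+ q)))

  board-complete : ∀ {c} → InB c → c ∈ board-cells
  board-complete {+ i , + j} ((_ , +<+ i<n) , (_ , +<+ j<n)) =
    ∈-cartesianProduct⁺ (∈-map⁺ +_ (∈-upTo⁺ i<n)) (∈-map⁺ +_ (∈-upTo⁺ j<n))

  reach-core : OAcyclic → ∀ {a} → InB a → ∃ λ c → InCore c × Star OAdj a c
  reach-core acyclic = reach
    where open AcyclicReach (≡-dec ℤ._≟_ ℤ._≟_) OAdj OAdj-sym OAdj-irrefl acyclic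
                            InB OAdj-board board-cells board-complete InCore classify

  to-F : OAcyclic → ∀ {a} → InB a → ∃ λ u → InF u × Star HAdj a (rep u)
  to-F acyclic a∈B =
    let c , (d , i , c∈) , a⇝c = reach-core acyclic a∈B
        u , πu , u∈F = core-proj d i c∈
    in  u , u∈F , O⊆H a⇝c ◅◅ to-rep d i u πu

  H-connected : OAcyclic → FConnected → HConnected
  H-connected acyclic F-connected a b a∈B b∈B =
    let u , u∈F , a⇝u = to-F acyclic a∈B
        w , w∈F , b⇝w = to-F acyclic b∈B
    in  a⇝u ◅◅ lift-path (F-connected u w u∈F w∈F) ◅◅ H-reverse b⇝w

open import Data.Nat using (ℕ; _<_; _+_; _∸_)
open import Data.Nat.Coprimality using (Coprime)

lemma3 : (p q : ℕ) → 0 < p → p < q → Coprime (q ∸ p) (p + q) →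
    Board.OAcyclic p q → Board.FConnected p q → Board.HConnected p q
lemma3 p q 0<p p<q coprime = KeyGraph.H-connected p q 0<p p<q coprime
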